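{- Let $G$ be a maximal triangle-free subgraph of $\mathcal D_n$. Then for each $i$, the vector $e_i$ is included in at most four vertices of $G$.
   Context: Let $e_1,\dots,e_n$ be an orthonormal basis of $\mathbb R^n$. $\mathcal D_n$ is the signed graph with the $n(n-1)$ vertices $e_i\pm e_j$ ($1\le i<j\le n$), distinct vertices $u,v$ being joined by an edge of sign $u\cdot v$ whenever $u\cdot v\ne0$. Subgraphs are induced subgraphs. A triangle is a set of three pairwise adjacent vertices. A maximal triangle-free subgraph of $\mathcal D_n$ is a triangle-free induced subgraph not contained in a strictly larger triangle-free induced subgraph of $\mathcal D_n$. A vertex $v=e_i\pm e_j$ is said to include $e_i$ and $e_j$. -}

module Defs where

open import Data.Nat using (ℕ)
open import Data.Bool using (Bool; true; false; if_then_else_)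
open import Data.Fin using (Fin; _<_; _≟_)
open import Data.Integer using (ℤ; +_; -_; _*_; _+_)
open import Data.Product using (_×_; ∃; Σ-syntax; ∃-syntax)
open import Data.Sum using (_⊎_)
open import Relation.Nullary using (¬_; does)
open import Relation.Binary.PropositionalEquality using (_≡_)
open import Function.Definitions using (Injective)

-- A vertex e_i + s e_j of D_n, with i < j; sign true means +, false means -.
record Vertex (n : ℕ) : Set where
  constructor vtx
  field
    i    : Fin n
    j    : Fin n
    i<j  : i < j
    sign : Bool
open Vertex public

vec : {n : ℕ} → Vertex n → Fin n → ℤ
vec v k =
  (if does (k ≟ i v) then + 1 else + 0) +
  (if does (k ≟ j v) then (if sign v then + 1 else - + 1) else + 0)

sumFin : (n : ℕ) → (Fin n → ℤ) → ℤ
sumFin ℕ.zero f = + 0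
sumFin (ℕ.suc n) f = f Fin.zero + sumFin n (λ k → f (Fin.suc k))

_·_ : {n : ℕ} → Vertex n → Vertex n → ℤ
_·_ {n} u v = sumFin n (λ k → vec u k * vec v k)

Adj : {n : ℕ} → Vertex n → Vertex n → Set
Adj u v = ¬ (u ≡ v) × ¬ (u · v ≡ + 0)

-- induced subgraphs are given by their vertex sets (predicates on vertices)
VSet : ℕ → Set₁
VSet n = Vertex n → Set

HasTriangle : {n : ℕ} → VSet n → Set
HasTriangle S = ∃[ u ] ∃[ v ] ∃[ w ]
  (S u × S v × S w × Adj u v × Adj v w × Adj u w)

TriangleFree : {n : ℕ} → VSet n → Set
TriangleFree S = ¬ HasTriangle S

MaximalTriangleFree : {n : ℕ} → VSet n → Set₁
MaximalTriangleFree {n} S =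
  TriangleFree S ×
  ((T : VSet n) → (∀ v → S v → T v) → TriangleFree T → ∀ v → T v → S v)

Includes : {n : ℕ} → Vertex n → Fin n → Set
Includes v k = (i v ≡ k) ⊎ (j v ≡ k)

module Submission where

open import Defs
open import Data.Nat using (ℕ; zero; suc; s≤s; z≤n; _<_)
open import Data.Nat.Properties using (≤-trans; <⇒≱; n<1+n)
open import Data.Fin using (Fin; _≟_; combine; fromℕ<) renaming (_<_ to _<ᶠ_)
open import Data.Fin.Patterns using (0F; 1F)
open import Data.Fin.Properties
  using (<-irrelevant; <-irrefl; <-asym; suc-injective; ¬∀⟶∃¬; injective⇒≤; combine-injective)
open import Data.Bool using (Bool; true; false; if_then_else_)
open import Data.Integer using (ℤ; +_; _*_)
open import Data.Integer.Properties using (+-identityˡ; +-identityʳ; *-zeroʳ; i*j≡0⇒i≡0∨j≡0)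
open import Data.Product using (_×_; _,_; proj₁; proj₂; ∃-syntax)
open import Data.Sum using (_⊎_; inj₁; inj₂; [_,_])
open import Data.Empty using (⊥-elim)
open import Function using (_∘_)
open import Function.Definitions using (Injective)
open import Relation.Binary.Definitions using (DecidableEquality)
open import Relation.Nullary using (¬_; yes; no; does; _⊎-dec_)
open import Relation.Nullary.Negation using (contradiction)
open import Relation.Binary.PropositionalEquality
  using (_≡_; _≢_; refl; sym; trans; cong; subst₂)

-- Proof idea: two vertices e_k ± e_m and e_k ± e_m' with m ≠ m' have inner
-- product ±1, so they are adjacent. The vertices including e_k are determined
-- by their other index m and their sign, so five of them use at least three
-- distinct indices m (two indices admit only four vertices); three vertices
-- with distinct m form a triangle.

module _ {A : Set} (_≟ᴬ_ : DecidableEquality A) {m : ℕ} (4<m : 4 < m)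
         (g : Fin m → A) (s : Fin m → Bool)
         (g×s-injective : ∀ a b → g a ≡ g b → s a ≡ s b → a ≡ b) where

  ¬image⊆pair : ∀ x y → ¬ (∀ a → g a ≡ x ⊎ g a ≡ y)
  ¬image⊆pair x y image⊆ = <⇒≱ 4<m (injective⇒≤ code-injective)
    where
    side : Fin m → Fin 2
    side a = if does (g a ≟ᴬ x) then 0F else 1F

    bit : Bool → Fin 2
    bit false = 0F
    bit true  = 1F

    bit-injective : Injective _≡_ _≡_ bit
    bit-injective {false} {false} _ = refl
    bit-injective {true}  {true}  _ = refl

    same-side : ∀ a b → side a ≡ side b → g a ≡ g b
    same-side a b eq with g a ≟ᴬ x | g b ≟ᴬ x | image⊆ a | image⊆ b
    ... | yes ga≡x | yes gb≡x | _         | _         = trans ga≡x (sym gb≡x)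
    ... | no ga≢x  | _        | inj₁ ga≡x | _         = contradiction ga≡x ga≢x
    ... | _        | no gb≢x  | _         | inj₁ gb≡x = contradiction gb≡x gb≢x
    ... | no _     | no _     | inj₂ ga≡y | inj₂ gb≡y = trans ga≡y (sym gb≡y)

    code : Fin m → Fin 4
    code a = combine (side a) (bit (s a))

    code-injective : Injective _≡_ _≡_ code
    code-injective {a} {b} eq with combine-injective (side a) (bit (s a)) (side b) (bit (s b)) eq
    ... | side≡ , bit≡ = g×s-injective a b (same-side a b side≡) (bit-injective bit≡)

  ∃-outside-pair : ∀ x y → ∃[ c ] (g c ≢ x × g c ≢ y)
  ∃-outside-pair x y with c , gc∉ ← ¬∀⟶∃¬ m _ (λ c → g c ≟ᴬ x ⊎-dec g c ≟ᴬ y) (¬image⊆pair x y)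
    = c , gc∉ ∘ inj₁ , gc∉ ∘ inj₂

  a₀ : Fin m
  a₀ = fromℕ< (≤-trans (s≤s z≤n) 4<m)

  three-distinct-values : ∃[ a ] ∃[ b ] ∃[ c ] (g a ≢ g b × g b ≢ g c × g a ≢ g c)
  three-distinct-values
    with b , gb≢ga₀ , _      ← ∃-outside-pair (g a₀) (g a₀)
    with c , gc≢ga₀ , gc≢gb ← ∃-outside-pair (g a₀) (g b)
    = a₀ , b , c , gb≢ga₀ ∘ sym , gc≢gb ∘ sym , gc≢ga₀ ∘ sym

sumFin-zero : ∀ n (f : Fin n → ℤ) → (∀ m → f m ≡ + 0) → sumFin n f ≡ + 0
sumFin-zero zero    f f≡0 = refl
sumFin-zero (suc n) f f≡0
  rewrite f≡0 Fin.zero | sumFin-zero n (f ∘ Fin.suc) (f≡0 ∘ Fin.suc) = refl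

sumFin-single : ∀ n (f : Fin n → ℤ) (k : Fin n) → (∀ m → m ≢ k → f m ≡ + 0) → sumFin n f ≡ f k
sumFin-single (suc n) f Fin.zero f≡0
  rewrite sumFin-zero n (f ∘ Fin.suc) (λ m → f≡0 (Fin.suc m) λ ()) = +-identityʳ (f Fin.zero)
sumFin-single (suc n) f (Fin.suc k) f≡0
  rewrite f≡0 Fin.zero (λ ())
        | sumFin-single n (f ∘ Fin.suc) k (λ m m≢k → f≡0 (Fin.suc m) (m≢k ∘ suc-injective))
  = +-identityˡ (f (Fin.suc k))

module _ {n : ℕ} where

  vertex-≡ : (u v : Vertex n) → i u ≡ i v → j u ≡ j v → sign u ≡ sign v → u ≡ v
  vertex-≡ (vtx a b p s) (vtx .a .b q .s) refl refl refl = cong (λ r → vtx a b r s) (<-irrelevant p q)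

  vec-outside : (u : Vertex n) (m : Fin n) → m ≢ i u → m ≢ j u → vec u m ≡ + 0
  vec-outside u m m≢i m≢j with m ≟ i u | m ≟ j u
  ... | yes m≡i | _       = contradiction m≡i m≢i
  ... | no _    | yes m≡j = contradiction m≡j m≢j
  ... | no _    | no _    = refl

  vec-included-≢0 : (u : Vertex n) (k : Fin n) → Includes u k → vec u k ≢ + 0
  vec-included-≢0 u k (inj₁ refl) with i u ≟ i u | i u ≟ j u
  ... | no i≢i | _       = contradiction refl i≢i
  ... | yes _  | yes i≡j = ⊥-elim (<-irrefl i≡j (i<j u))
  ... | yes _  | no _    = λ ()
  vec-included-≢0 u k (inj₂ refl) with j u ≟ i u | j u ≟ j u | sign u
  ... | yes j≡i | _      | _     = ⊥-elim (<-irrefl (sym j≡i) (i<j u))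
  ... | no _    | no j≢j | _     = contradiction refl j≢j
  ... | no _    | yes _  | true  = λ ()
  ... | no _    | yes _  | false = λ ()

  other : Vertex n → Fin n → Fin n
  other u k = if does (i u ≟ k) then j u else i u

  includes-split : (u : Vertex n) (k : Fin n) → Includes u k →
    (i u ≡ k × j u ≡ other u k) ⊎ (j u ≡ k × i u ≡ other u k)
  includes-split u k includes with i u ≟ k | includes
  ... | yes i≡k | _        = inj₁ (i≡k , refl)
  ... | no i≢k  | inj₁ i≡k = contradiction i≡k i≢k
  ... | no _    | inj₂ j≡k = inj₂ (j≡k , refl)

  vec-outside-edge : (u : Vertex n) (k m : Fin n) → Includes u k →
    m ≢ k → m ≢ other u k → vec u m ≡ + 0
  vec-outside-edge u k m includes m≢k m≢o with includes-split u k includes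
  ... | inj₁ (i≡k , j≡o) = vec-outside u m (λ m≡i → m≢k (trans m≡i i≡k)) (λ m≡j → m≢o (trans m≡j j≡o))
  ... | inj₂ (j≡k , i≡o) = vec-outside u m (λ m≡i → m≢o (trans m≡i i≡o)) (λ m≡j → m≢k (trans m≡j j≡k))

  included-vertex-≡ : (u v : Vertex n) (k : Fin n) → Includes u k → Includes v k →
    other u k ≡ other v k → sign u ≡ sign v → u ≡ v
  included-vertex-≡ u v k u∋k v∋k o≡o s≡s with includes-split u k u∋k | includes-split v k v∋k
  ... | inj₁ (iu≡k , ju≡o) | inj₁ (iv≡k , jv≡o) =
    vertex-≡ u v (trans iu≡k (sym iv≡k)) (trans ju≡o (trans o≡o (sym jv≡o))) s≡s
  ... | inj₂ (ju≡k , iu≡o) | inj₂ (jv≡k , iv≡o) =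
    vertex-≡ u v (trans iu≡o (trans o≡o (sym iv≡o))) (trans ju≡k (sym jv≡k)) s≡s
  -- In the mixed cases k would be both smaller and larger than the shared other index.
  ... | inj₁ (iu≡k , ju≡o) | inj₂ (jv≡k , iv≡o) =
    ⊥-elim (<-asym (i<j u)
      (subst₂ _<ᶠ_ (trans iv≡o (trans (sym o≡o) (sym ju≡o))) (trans jv≡k (sym iu≡k)) (i<j v)))
  ... | inj₂ (ju≡k , iu≡o) | inj₁ (iv≡k , jv≡o) =
    ⊥-elim (<-asym (i<j v)
      (subst₂ _<ᶠ_ (trans iu≡o (trans o≡o (sym jv≡o))) (trans ju≡k (sym iv≡k)) (i<j u)))

  sharing-index-adjacent : (u v : Vertex n) (k : Fin n) → Includes u k → Includes v k →
    other u k ≢ other v k → Adj u v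
  sharing-index-adjacent u v k u∋k v∋k o≢o = o≢o ∘ cong (λ w → other w k) , u·v≢0
    where
    product-outside-k : ∀ m → m ≢ k → vec u m * vec v m ≡ + 0
    product-outside-k m m≢k with m ≟ other u k
    ... | no m≢o rewrite vec-outside-edge u k m u∋k m≢k m≢o = refl
    ... | yes refl rewrite vec-outside-edge v k m v∋k m≢k o≢o = *-zeroʳ (vec u m)

    u·v≢0 : u · v ≢ + 0
    u·v≢0 u·v≡0 =
      [ vec-included-≢0 u k u∋k , vec-included-≢0 v k v∋k ]
        (i*j≡0⇒i≡0∨j≡0 (vec u k)
          (trans (sym (sumFin-single n (λ m → vec u m * vec v m) k product-outside-k)) u·v≡0))

lemma7p8 : (n : ℕ) (G : VSet n) → MaximalTriangleFree G → (k : Fin n) →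
    ¬ (∃[ f ] (Injective _≡_ _≡_ f ×
    (∀ (a : Fin 5) → G (f a) × Includes (f a) k)))
lemma7p8 n G (triangle-free , _) k (f , f-injective , f∈G∋k) =
  triangle-free (triangle (three-distinct-values _≟_ (n<1+n 4) g (sign ∘ f) g×sign-injective))
  where
  ∈G : ∀ a → G (f a)
  ∈G = proj₁ ∘ f∈G∋k

  ∋k : ∀ a → Includes (f a) k
  ∋k = proj₂ ∘ f∈G∋k

  g : Fin 5 → Fin n
  g a = other (f a) k

  g×sign-injective : ∀ a b → g a ≡ g b → sign (f a) ≡ sign (f b) → a ≡ b
  g×sign-injective a b g≡ s≡ = f-injective (included-vertex-≡ (f a) (f b) k (∋k a) (∋k b) g≡ s≡)

  adjacent : ∀ a b → g a ≢ g b → Adj (f a) (f b)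
  adjacent a b = sharing-index-adjacent (f a) (f b) k (∋k a) (∋k b)

  triangle : ∃[ a ] ∃[ b ] ∃[ c ] (g a ≢ g b × g b ≢ g c × g a ≢ g c) → HasTriangle G
  triangle (a , b , c , ga≢gb , gb≢gc , ga≢gc) =
    f a , f b , f c , ∈G a , ∈G b , ∈G c , adjacent a b ga≢gb , adjacent b c gb≢gc , adjacent a c ga≢gc
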